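{- Let $h\geq 1$ be an integer and let $A$ be a finite set of $k$ nonnegative integers with $0\in A$. Then \[|h_{\pm}A| \geq 2hk-2h+1.\] This lower bound is best possible: for $A=\{0,1,\ldots,k-1\}$ one has $|h_{\pm}A|=2hk-2h+1$.
   Context: For a finite set $A=\{a_0,a_1,\ldots,a_{k-1}\}$ of integers and a positive integer $h$, the $h$-fold signed sumset of $A$ is \[h_{\pm}A=\Big\{\sum_{i=0}^{k-1}\lambda_i a_i : (\lambda_0,\ldots,\lambda_{k-1})\in\mathbb{Z}^k,\ \sum_{i=0}^{k-1}|\lambda_i|=h\Big\}.\] -}

module Defs where

open import Data.Nat using (ℕ; suc)
open import Data.Integer as ℤ using (ℤ; +_; ∣_∣)
open import Data.Fin using (Fin; toℕ)
open import Data.Vec using (Vec; lookup; tabulate; foldr)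
open import Data.List using (List; length)
open import Data.List.Membership.Propositional using (_∈_)
open import Data.List.Relation.Unary.Unique.Propositional using (Unique)
open import Data.Product using (Σ; _×_)
open import Relation.Binary.PropositionalEquality using (_≡_)
open import Function.Bundles using (_⇔_)

sumℤ : ∀ {k} → Vec ℤ k → ℤ
sumℤ = foldr _ ℤ._+_ (+ 0)

sumℕ : ∀ {k} → Vec ℕ k → ℕ
sumℕ = foldr _ Data.Nat._+_ 0

-- x ∈ h±A, where A = {a_0,...,a_{k-1}} is given as a vector (a i = a_i)
-- x = Σ λ_i a_i for some λ ∈ ℤ^k with Σ |λ_i| = h
InSignedSumset : ∀ {k} → ℕ → Vec ℤ k → ℤ → Set
InSignedSumset {k} h a x =
  Σ (Vec ℤ k) λ lam →
    (sumℕ (tabulate λ i → ∣ lookup lam i ∣) ≡ h) ×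
    (sumℤ (tabulate λ i → lookup lam i ℤ.* lookup a i) ≡ x)

HasCard : (ℤ → Set) → ℕ → Set
HasCard S n =
  Σ (List ℤ) λ L → Unique L × (∀ x → (x ∈ L) ⇔ S x) × (length L ≡ n)

interval : (k : ℕ) → Vec ℤ k
interval k = tabulate λ i → + toℕ i

-- Sort A as x₀ < x₁ < … < x_{k-1}.  Stepping from h x_t to h x_{t+1} by trading one
-- copy of x_t for one of x_{t+1} at a time gives the strictly increasing chain
-- h x₀ < (h-1) x₀ + x₁ < … < h x₁ < … < h x_{k-1} of h(k-1)+1 elements of the
-- ordinary sumset hA ⊆ h±A.  The negatives of the h(k-1) chain elements above
-- h x₀ ≥ 0 are negative, hence new, and lie in h±A as well: 2h(k-1)+1 elements.
-- For A = {0,…,k-1} every element of h±A has absolute value at most h(k-1), so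
-- the bound is attained.  Finiteness of h±A comes from enumerating the
-- coefficient vectors in [-h,h]^k.

module Submission where

open import Defs
open import Data.Nat using (ℕ; zero; suc; _+_; _*_; _∸_; _≥_; _≤_; _<_; z≤n; s≤s)
import Data.Nat.Properties as ℕₚ
open import Data.Nat.Tactic.RingSolver using (solve-∀)
open import Data.Integer as ℤ using (ℤ; +_; -[1+_]; ∣_∣)
import Data.Integer.Properties as ℤₚ
open import Data.Fin using (Fin; toℕ) renaming (zero to fzero; suc to fsuc)
import Data.Fin.Properties as Finₚ
open import Data.Vec using (Vec; []; _∷_; lookup; tabulate)
import Data.Vec.Properties as Vecₚ
open import Data.List as List using (List; []; _∷_; _++_; length)
import Data.List.Properties as Listₚ
open import Data.List.Membership.Propositional using (_∈_)
open import Data.List.Membership.Propositional.Properties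
open import Data.List.Relation.Unary.All as All using (All; []; _∷_)
import Data.List.Relation.Unary.All.Properties as Allₚ
open import Data.List.Relation.Unary.Any using (here; there)
open import Data.List.Relation.Unary.AllPairs as AllPairs using (AllPairs; []; _∷_)
open import Data.List.Relation.Unary.Linked using (Linked; []; [-]; _∷_)
open import Data.List.Relation.Unary.Linked.Properties using (Linked⇒AllPairs)
open import Data.List.Relation.Binary.Subset.Propositional using (_⊆_)
open import Data.List.Relation.Unary.Unique.Propositional using (Unique)
import Data.List.Relation.Unary.Unique.Propositional.Properties as Uniqueₚ
open import Data.List.Relation.Unary.Unique.DecPropositional.Properties ℤ._≟_ using (deduplicate-!)
open import Data.List.Relation.Binary.Permutation.Propositional using (↭-sym; ↭⇒↭ₛ)
open import Data.List.Relation.Binary.Permutation.Propositional.Properties using (∈-resp-↭; ↭-length)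
open import Relation.Binary.PropositionalEquality.Properties using (setoid)
open import Data.List.Relation.Binary.Permutation.Setoid.Properties (setoid ℕ) using (Unique-resp-↭)
open import Data.List.Sort ℕₚ.≤-decTotalOrder using (sort; sort-↭; sort-↗)
open import Data.Product using (Σ; _×_; _,_; proj₂)
open import Data.Sum using (inj₁; inj₂)
open import Data.Empty using (⊥; ⊥-elim)
open import Function.Bundles using (mk⇔; Equivalence)
open import Function.Definitions using (Injective)
open import Relation.Binary.PropositionalEquality

sumℕ-+ : ∀ {k} (f g : Fin k → ℕ) →
         sumℕ (tabulate λ i → f i + g i) ≡ sumℕ (tabulate f) + sumℕ (tabulate g)
sumℕ-+ {zero}  f g = refl
sumℕ-+ {suc k} f g = begin
  f fzero + g fzero + sumℕ (tabulate λ i → f (fsuc i) + g (fsuc i))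
    ≡⟨ cong (_+_ (f fzero + g fzero)) (sumℕ-+ (λ i → f (fsuc i)) (λ i → g (fsuc i))) ⟩
  f fzero + g fzero + (sumℕ (tabulate (λ i → f (fsuc i))) + sumℕ (tabulate (λ i → g (fsuc i))))
    ≡⟨ interchange (f fzero) (g fzero) _ _ ⟩
  f fzero + sumℕ (tabulate (λ i → f (fsuc i))) + (g fzero + sumℕ (tabulate (λ i → g (fsuc i)))) ∎
  where
  open ≡-Reasoning
  interchange : ∀ a b c d → a + b + (c + d) ≡ a + c + (b + d)
  interchange = solve-∀

sumℕ-zero : ∀ k → sumℕ (tabulate {k} λ _ → 0) ≡ 0
sumℕ-zero zero    = refl
sumℕ-zero (suc k) = sumℕ-zero k

sumℤ-pos : ∀ {k} (f : Fin k → ℕ) → sumℤ (tabulate λ i → + f i) ≡ + sumℕ (tabulate f)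
sumℤ-pos {zero}  f = refl
sumℤ-pos {suc k} f = trans (cong (ℤ._+_ (+ f fzero)) (sumℤ-pos (λ i → f (fsuc i))))
                           (sym (ℤₚ.pos-+ (f fzero) _))

sumℤ-neg : ∀ {k} (f : Fin k → ℤ) → sumℤ (tabulate λ i → ℤ.- f i) ≡ ℤ.- sumℤ (tabulate f)
sumℤ-neg {zero}  f = refl
sumℤ-neg {suc k} f = trans (cong (ℤ._+_ (ℤ.- f fzero)) (sumℤ-neg (λ i → f (fsuc i))))
                           (sym (ℤₚ.neg-distrib-+ (f fzero) _))

absSum : ∀ {k} → Vec ℤ k → ℕ
absSum λs = sumℕ (tabulate λ i → ∣ lookup λs i ∣)

weightedSum : ∀ {k} → Vec ℤ k → Vec ℤ k → ℤ
weightedSum a λs = sumℤ (tabulate λ i → lookup λs i ℤ.* lookup a i)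

indicator : ∀ {k} → Fin k → ℕ → Fin k → ℕ
indicator fzero    u fzero    = u
indicator fzero    u (fsuc i) = 0
indicator (fsuc p) u fzero    = 0
indicator (fsuc p) u (fsuc i) = indicator p u i

sum-indicator : ∀ {k} (p : Fin k) u → sumℕ (tabulate (indicator p u)) ≡ u
sum-indicator {suc k} fzero    u = trans (cong (_+_ u) (sumℕ-zero k)) (ℕₚ.+-identityʳ u)
sum-indicator {suc k} (fsuc p) u = sum-indicator p u

sum-indicator-* : ∀ {k} (p : Fin k) u (g : Fin k → ℕ) →
                  sumℕ (tabulate λ i → indicator p u i * g i) ≡ u * g p
sum-indicator-* {suc k} fzero    u g = trans (cong (_+_ (u * g fzero)) (sumℕ-zero k)) (ℕₚ.+-identityʳ _)
sum-indicator-* {suc k} (fsuc p) u g = sum-indicator-* p u (λ i → g (fsuc i))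

InSumset : ∀ {k} → ℕ → (Fin k → ℕ) → ℕ → Set
InSumset {k} h g e =
  Σ (Fin k → ℕ) λ c → sumℕ (tabulate c) ≡ h × sumℕ (tabulate λ i → c i * g i) ≡ e

module _ {k : ℕ} (g : Fin k → ℕ) where

  multiple-∈-sumset : ∀ u {x} → x ∈ List.tabulate g → InSumset u g (u * x)
  multiple-∈-sumset u x∈ with ∈-tabulate⁻ x∈
  ... | i , refl = indicator i u , sum-indicator i u , sum-indicator-* i u g

  sumset-+ : ∀ {h h′ e e′} → InSumset h g e → InSumset h′ g e′ → InSumset (h + h′) g (e + e′)
  sumset-+ (c , ∑c , ∑cg) (c′ , ∑c′ , ∑c′g) =
    (λ i → c i + c′ i) ,
    trans (sumℕ-+ c c′) (cong₂ _+_ ∑c ∑c′) ,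
    trans (cong sumℕ (Vecₚ.tabulate-cong λ i → ℕₚ.*-distribʳ-+ (g i) (c i) (c′ i)))
          (trans (sumℕ-+ (λ i → c i * g i) (λ i → c′ i * g i)) (cong₂ _+_ ∑cg ∑c′g))

  sumset⊆signedSumset : ∀ {h e} (a : Vec ℤ k) → (∀ i → lookup a i ≡ + g i) →
                        InSumset h g e → InSignedSumset h a (+ e)
  sumset⊆signedSumset {h} {e} a a≡g (c , ∑c , ∑cg) = λs , ∑∣λ∣ , ∑λa
    where
    λs : Vec ℤ k
    λs = tabulate λ i → + c i
    ∑∣λ∣ : absSum λs ≡ h
    ∑∣λ∣ = trans (cong sumℕ (Vecₚ.tabulate-cong λ i → cong ∣_∣ (Vecₚ.lookup∘tabulate (λ j → + c j) i))) ∑c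
    ∑λa : weightedSum a λs ≡ + e
    ∑λa = begin
      weightedSum a λs
        ≡⟨ cong sumℤ (Vecₚ.tabulate-cong λ i →
             trans (cong₂ ℤ._*_ (Vecₚ.lookup∘tabulate (λ j → + c j) i) (a≡g i)) (sym (ℤₚ.pos-* (c i) (g i)))) ⟩
      sumℤ (tabulate λ i → + (c i * g i))  ≡⟨ sumℤ-pos (λ i → c i * g i) ⟩
      + sumℕ (tabulate λ i → c i * g i)    ≡⟨ cong +_ ∑cg ⟩
      + e                                  ∎
      where open ≡-Reasoning

signedSumset-neg : ∀ {h k x} {a : Vec ℤ k} → InSignedSumset h a x → InSignedSumset h a (ℤ.- x)
signedSumset-neg {h} {k} {x} {a} (λs , ∑∣λ∣ , ∑λa) = Data.Vec.map ℤ.-_ λs , ∑∣-λ∣ , ∑-λa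
  where
  -λ≡ : ∀ i → lookup (Data.Vec.map ℤ.-_ λs) i ≡ ℤ.- lookup λs i
  -λ≡ i = Vecₚ.lookup-map i ℤ.-_ λs
  ∑∣-λ∣ : absSum (Data.Vec.map ℤ.-_ λs) ≡ h
  ∑∣-λ∣ = trans (cong sumℕ (Vecₚ.tabulate-cong λ i →
            trans (cong ∣_∣ (-λ≡ i)) (ℤₚ.∣-i∣≡∣i∣ (lookup λs i)))) ∑∣λ∣
  ∑-λa : weightedSum a (Data.Vec.map ℤ.-_ λs) ≡ ℤ.- x
  ∑-λa = trans (cong sumℤ (Vecₚ.tabulate-cong λ i →
           trans (cong (ℤ._* lookup a i) (-λ≡ i)) (sym (ℤₚ.neg-distribˡ-* (lookup λs i) (lookup a i)))))
         (trans (sumℤ-neg (λ i → lookup λs i ℤ.* lookup a i)) (cong ℤ.-_ ∑λa))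

Unique∧⊆⇒length≤ : ∀ {A : Set} {xs ys : List A} → Unique xs → xs ⊆ ys → length xs ≤ length ys
Unique∧⊆⇒length≤ {xs = []}     _             _     = z≤n
Unique∧⊆⇒length≤ {xs = x ∷ xs} (x∉xs ∷ uniq) xs⊆ys with ∈-∃++ (xs⊆ys (here refl))
... | ys₁ , ys₂ , refl = subst (suc (length xs) ≤_) (sym length-middle)
                           (s≤s (Unique∧⊆⇒length≤ uniq xs⊆ys₁++ys₂))
  where
  length-middle : length (ys₁ ++ x ∷ ys₂) ≡ suc (length (ys₁ ++ ys₂))
  length-middle = trans (Listₚ.length-++ ys₁)
                    (trans (ℕₚ.+-suc (length ys₁) (length ys₂)) (cong suc (sym (Listₚ.length-++ ys₁))))
  xs⊆ys₁++ys₂ : xs ⊆ ys₁ ++ ys₂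
  xs⊆ys₁++ys₂ y∈xs with ∈-++⁻ ys₁ (xs⊆ys (there y∈xs))
  ... | inj₁ y∈ys₁         = ∈-++⁺ˡ y∈ys₁
  ... | inj₂ (here y≡x)    = ⊥-elim (All.lookup x∉xs y∈xs (sym y≡x))
  ... | inj₂ (there y∈ys₂) = ∈-++⁺ʳ ys₁ y∈ys₂

Linked-≤∧Unique⇒Linked-< : ∀ {xs} → Linked _≤_ xs → Unique xs → Linked _<_ xs
Linked-≤∧Unique⇒Linked-< []          _                    = []
Linked-≤∧Unique⇒Linked-< [-]         _                    = [-]
Linked-≤∧Unique⇒Linked-< (x≤y ∷ x≤*) ((x≢y ∷ _) ∷ uniq) =
  ℕₚ.≤∧≢⇒< x≤y x≢y ∷ Linked-≤∧Unique⇒Linked-< x≤* uniq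

module _ {k : ℕ} {g : Fin k → ℕ} (g-inj : ∀ {i j} → g i ≡ g j → i ≡ j) where

  sortedImage : List ℕ
  sortedImage = sort (List.tabulate g)

  sortedImage-strict : Linked _<_ sortedImage
  sortedImage-strict = Linked-≤∧Unique⇒Linked-< (sort-↗ _)
    (Unique-resp-↭ (↭⇒↭ₛ (↭-sym (sort-↭ _))) (Uniqueₚ.tabulate⁺ g-inj))

  sortedImage⊆image : sortedImage ⊆ List.tabulate g
  sortedImage⊆image = ∈-resp-↭ (sort-↭ _)

  length-sortedImage : length sortedImage ≡ k
  length-sortedImage = trans (↭-length (sort-↭ _)) (Listₚ.length-tabulate g)

module _ (h : ℕ) where

  between : ℕ → ℕ → ℕ → ℕ → List ℕ
  between x y zero    v = []
  between x y (suc u) v = u * x + suc v * y ∷ between x y u (suc v)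

  -- for x < y < …, h x ∷ ascent x ys is the chain h x < (h-1) x + y < … < h y < …
  ascent : ℕ → List ℕ → List ℕ
  ascent x []       = []
  ascent x (y ∷ ys) = between x y h 0 ++ ascent y ys

  length-between : ∀ x y u v → length (between x y u v) ≡ u
  length-between x y zero    v = refl
  length-between x y (suc u) v = cong suc (length-between x y u (suc v))

  length-ascent : ∀ x ys → length (ascent x ys) ≡ h * length ys
  length-ascent x []       = sym (ℕₚ.*-zeroʳ h)
  length-ascent x (y ∷ ys) = begin
    length (between x y h 0 ++ ascent y ys)           ≡⟨ Listₚ.length-++ (between x y h 0) ⟩
    length (between x y h 0) + length (ascent y ys)   ≡⟨ cong₂ _+_ (length-between x y h 0) (length-ascent y ys) ⟩
    h + h * length ys                                 ≡⟨ ℕₚ.*-suc h (length ys) ⟨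
    h * suc (length ys)                               ∎
    where open ≡-Reasoning

  between-linked : ∀ {x y} → x < y → ∀ u v {zs} → Linked _<_ ((u + v) * y ∷ zs) →
                   Linked _<_ (u * x + v * y ∷ between x y u v ++ zs)
  between-linked x<y zero    v l = l
  between-linked {x} {y} x<y (suc u) v {zs} l =
    step ∷ between-linked x<y u (suc v) (subst (λ n → Linked _<_ (n * y ∷ zs)) (sym (ℕₚ.+-suc u v)) l)
    where
    step : suc u * x + v * y < u * x + suc v * y
    step = subst₂ _<_ (sym (ℕₚ.+-assoc x (u * x) (v * y))) (shift y (u * x) (v * y))
                  (ℕₚ.+-monoˡ-< (u * x + v * y) x<y)
      where
      shift : ∀ p q r → p + (q + r) ≡ q + (p + r)
      shift = solve-∀

  ascent-linked : ∀ {x ys} → Linked _<_ (x ∷ ys) → Linked _<_ (h * x ∷ ascent x ys)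
  ascent-linked [-] = [-]
  ascent-linked {x} {y ∷ ys} (x<y ∷ y<*) =
    subst (λ n → Linked _<_ (n ∷ between x y h 0 ++ ascent y ys)) (ℕₚ.+-identityʳ (h * x))
      (between-linked x<y h 0 (subst (λ n → Linked _<_ (n * y ∷ ascent y ys)) (sym (ℕₚ.+-identityʳ h))
                                (ascent-linked y<*)))

  module _ {k : ℕ} (g : Fin k → ℕ) where

    between⊆sumset : ∀ {x y} → x ∈ List.tabulate g → y ∈ List.tabulate g →
                     ∀ u v → All (InSumset (u + v) g) (between x y u v)
    between⊆sumset x∈ y∈ zero    v = []
    between⊆sumset {x} {y} x∈ y∈ (suc u) v = subst (λ n → All (InSumset n g) (between x y (suc u) v)) (ℕₚ.+-suc u v)
      (sumset-+ g (multiple-∈-sumset g u x∈) (multiple-∈-sumset g (suc v) y∈) ∷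
       between⊆sumset x∈ y∈ u (suc v))

    ascent⊆sumset : ∀ {x ys} → x ∷ ys ⊆ List.tabulate g → All (InSumset h g) (ascent x ys)
    ascent⊆sumset {x} {[]}     _  = []
    ascent⊆sumset {x} {y ∷ ys} ⊆g =
      Allₚ.++⁺ (subst (λ n → All (InSumset n g) (between x y h 0)) (ℕₚ.+-identityʳ h)
                 (between⊆sumset (⊆g (here refl)) (⊆g (there (here refl))) h 0))
               (ascent⊆sumset (λ z∈ → ⊆g (there z∈)))

mirror : ℕ → List ℕ → List ℤ
mirror p R = List.map (λ n → ℤ.- + n) R ++ List.map +_ (p ∷ R)

length-mirror : ∀ p R → length (mirror p R) ≡ 2 * length R + 1
length-mirror p R = begin
  length (mirror p R)
    ≡⟨ Listₚ.length-++ (List.map (λ n → ℤ.- + n) R) ⟩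
  length (List.map (λ n → ℤ.- + n) R) + length (List.map +_ (p ∷ R))
    ≡⟨ cong₂ _+_ (Listₚ.length-map (λ n → ℤ.- + n) R) (Listₚ.length-map +_ (p ∷ R)) ⟩
  length R + suc (length R)
    ≡⟨ double (length R) ⟩
  2 * length R + 1 ∎
  where
  open ≡-Reasoning
  double : ∀ n → n + suc n ≡ 2 * n + 1
  double = solve-∀

neg≢pos : ∀ {p n m} → p < n → ℤ.- + n ≢ + m
neg≢pos {n = suc n} _ ()

mirror-unique : ∀ {p R} → AllPairs _<_ (p ∷ R) → Unique (mirror p R)
mirror-unique {p} {R} (p<R ∷ R↑) =
  Uniqueₚ.++⁺ (Uniqueₚ.map⁺ (λ eq → ℤₚ.+-injective (ℤₚ.neg-injective eq)) (AllPairs.map ℕₚ.<⇒≢ R↑))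
              (Uniqueₚ.map⁺ ℤₚ.+-injective (AllPairs.map ℕₚ.<⇒≢ (p<R ∷ R↑)))
              disjoint
  where
  disjoint : ∀ {z} → z ∈ List.map (λ n → ℤ.- + n) R × z ∈ List.map +_ (p ∷ R) → ⊥
  disjoint (z∈neg , z∈pos) with ∈-map⁻ (λ n → ℤ.- + n) z∈neg | ∈-map⁻ +_ z∈pos
  ... | n , n∈R , refl | m , _ , eq = neg≢pos (All.lookup p<R n∈R) eq

module _ (h : ℕ) {k : ℕ} (g : Fin k → ℕ) (a : Vec ℤ k) (a≡g : ∀ i → lookup a i ≡ + g i) where

  mirror⊆signedSumset : ∀ {p R} → All (InSumset h g) (p ∷ R) → All (InSignedSumset h a) (mirror p R)
  mirror⊆signedSumset (p∈ ∷ R⊆) =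
    Allₚ.++⁺ (Allₚ.map⁺ (All.map (λ e∈ → signedSumset-neg {a = a} (sumset⊆signedSumset g a a≡g e∈)) R⊆))
             (Allₚ.map⁺ (All.map (sumset⊆signedSumset g a a≡g) (p∈ ∷ R⊆)))

  increasing-signedSumset-card≥ : ∀ {x ys n} → Linked _<_ (x ∷ ys) → x ∷ ys ⊆ List.tabulate g →
                 HasCard (InSignedSumset h a) n → 2 * h * length ys + 1 ≤ n
  increasing-signedSumset-card≥ {x} {ys} x<ys xs⊆g (L , _ , L⇔ , refl) = begin
    2 * h * length ys + 1                      ≡⟨ cong (λ m → m + 1) (ℕₚ.*-assoc 2 h (length ys)) ⟩
    2 * (h * length ys) + 1                    ≡⟨ cong (λ m → 2 * m + 1) (length-ascent h x ys) ⟨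
    2 * length (ascent h x ys) + 1             ≡⟨ length-mirror (h * x) (ascent h x ys) ⟨
    length (mirror (h * x) (ascent h x ys))    ≤⟨ Unique∧⊆⇒length≤ unique mirror⊆L ⟩
    length L                                   ∎
    where
    open ℕₚ.≤-Reasoning
    unique : Unique (mirror (h * x) (ascent h x ys))
    unique = mirror-unique (Linked⇒AllPairs ℕₚ.<-trans (ascent-linked h x<ys))
    mirror⊆L : mirror (h * x) (ascent h x ys) ⊆ L
    mirror⊆L z∈ = Equivalence.from (L⇔ _) (All.lookup members z∈)
      where
      members : All (InSignedSumset h a) (mirror (h * x) (ascent h x ys))
      members = mirror⊆signedSumset (multiple-∈-sumset g h (xs⊆g (here refl)) ∷ ascent⊆sumset h g xs⊆g)

signedSumset-card≥ : ∀ h {k n} (a : Vec ℤ (suc k)) (g : Fin (suc k) → ℕ) → (∀ {i j} → g i ≡ g j → i ≡ j) →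
                     (∀ i → lookup a i ≡ + g i) → HasCard (InSignedSumset h a) n → 2 * h * k + 1 ≤ n
signedSumset-card≥ h {k} {n} a g g-inj a≡g card =
  fromSorted (sortedImage g-inj) (sortedImage-strict g-inj) (sortedImage⊆image g-inj) (length-sortedImage g-inj)
  where
  fromSorted : ∀ xs → Linked _<_ xs → xs ⊆ List.tabulate g → length xs ≡ suc k → 2 * h * k + 1 ≤ n
  fromSorted (x ∷ ys) x<ys xs⊆g len =
    subst (λ m → 2 * h * m + 1 ≤ n) (ℕₚ.suc-injective len) (increasing-signedSumset-card≥ h g a a≡g x<ys xs⊆g card)

∣weightedSum∣≤ : ∀ {k} (a λs : Vec ℤ k) {B} → (∀ i → ∣ lookup a i ∣ ≤ B) →
                  ∣ weightedSum a λs ∣ ≤ absSum λs * B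
∣weightedSum∣≤ []      []       _   = z≤n
∣weightedSum∣≤ (x ∷ a) (l ∷ λs) {B} a≤B = begin
  ∣ l ℤ.* x ℤ.+ weightedSum a λs ∣      ≤⟨ ℤₚ.∣i+j∣≤∣i∣+∣j∣ (l ℤ.* x) (weightedSum a λs) ⟩
  ∣ l ℤ.* x ∣ + ∣ weightedSum a λs ∣    ≡⟨ cong (_+ ∣ weightedSum a λs ∣) (ℤₚ.∣i*j∣≡∣i∣*∣j∣ l x) ⟩
  ∣ l ∣ * ∣ x ∣ + ∣ weightedSum a λs ∣  ≤⟨ ℕₚ.+-mono-≤ (ℕₚ.*-monoʳ-≤ ∣ l ∣ (a≤B fzero))
                                                       (∣weightedSum∣≤ a λs (λ i → a≤B (fsuc i))) ⟩
  ∣ l ∣ * B + absSum λs * B             ≡⟨ ℕₚ.*-distribʳ-+ B ∣ l ∣ (absSum λs) ⟨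
  absSum (l ∷ λs) * B                   ∎
  where open ℕₚ.≤-Reasoning

signedSumset-bounded : ∀ {h k x B} (a : Vec ℤ k) → (∀ i → ∣ lookup a i ∣ ≤ B) →
                       InSignedSumset h a x → ∣ x ∣ ≤ h * B
signedSumset-bounded a a≤B (λs , refl , refl) = ∣weightedSum∣≤ a λs a≤B

range : ℕ → List ℤ
range zero    = + 0 ∷ []
range (suc m) = + suc m ∷ -[1+ m ] ∷ range m

∈-range⁺ : ∀ {m} z → ∣ z ∣ ≤ m → z ∈ range m
∈-range⁺ {zero}  (+ zero)   _ = here refl
∈-range⁺ {suc m} (+ n)      ∣z∣≤ with ℕₚ.m≤n⇒m<n∨m≡n ∣z∣≤
... | inj₁ (s≤s ∣z∣≤m) = there (there (∈-range⁺ (+ n) ∣z∣≤m))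
... | inj₂ refl        = here refl
∈-range⁺ {suc m} -[1+ n ]   ∣z∣≤ with ℕₚ.m≤n⇒m<n∨m≡n ∣z∣≤
... | inj₁ (s≤s ∣z∣≤m) = there (there (∈-range⁺ -[1+ n ] ∣z∣≤m))
... | inj₂ refl        = there (here refl)

∈-range⁻ : ∀ {m z} → z ∈ range m → ∣ z ∣ ≤ m
∈-range⁻ {zero}  (here refl)                = z≤n
∈-range⁻ {suc m} (here refl)                = ℕₚ.≤-refl
∈-range⁻ {suc m} (there (here refl))        = ℕₚ.≤-refl
∈-range⁻ {suc m} (there (there z∈range[m])) = ℕₚ.m≤n⇒m≤1+n (∈-range⁻ z∈range[m])

length-range : ∀ m → length (range m) ≡ 2 * m + 1
length-range zero    = refl
length-range (suc m) = trans (cong (λ n → suc (suc n)) (length-range m)) (two-more m)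
  where
  two-more : ∀ m → suc (suc (2 * m + 1)) ≡ 2 * suc m + 1
  two-more = solve-∀

range-unique : ∀ m → Unique (range m)
range-unique zero    = [] ∷ []
range-unique (suc m) = ((λ ()) ∷ All.tabulate (outside (+ suc m) refl)) ∷
                       All.tabulate (outside -[1+ m ] refl) ∷ range-unique m
  where
  outside : ∀ w → ∣ w ∣ ≡ suc m → ∀ {z} → z ∈ range m → w ≢ z
  outside w ∣w∣≡ w∈range[m] refl = ℕₚ.1+n≰n (subst (_≤ m) ∣w∣≡ (∈-range⁻ w∈range[m]))

signedSumset-card≤ : ∀ {h k n B} (a : Vec ℤ k) → (∀ i → ∣ lookup a i ∣ ≤ B) →
                     HasCard (InSignedSumset h a) n → n ≤ 2 * h * B + 1
signedSumset-card≤ {h} {B = B} a a≤B (L , L-unique , L⇔ , refl) =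
  subst (length L ≤_) (trans (length-range (h * B)) (cong (_+ 1) (sym (ℕₚ.*-assoc 2 h B))))
        (Unique∧⊆⇒length≤ L-unique L⊆range)
  where
  L⊆range : L ⊆ range (h * B)
  L⊆range z∈L = ∈-range⁺ _ (signedSumset-bounded a a≤B (Equivalence.to (L⇔ _) z∈L))

vecsOver : ∀ {A : Set} → List A → (k : ℕ) → List (Vec A k)
vecsOver R zero    = [] ∷ []
vecsOver R (suc k) = List.cartesianProductWith _∷_ R (vecsOver R k)

∈-vecsOver : ∀ {A : Set} {R : List A} {k} (v : Vec A k) → (∀ i → lookup v i ∈ R) → v ∈ vecsOver R k
∈-vecsOver []      _   = here refl
∈-vecsOver (x ∷ v) v⊆R = ∈-cartesianProductWith⁺ _∷_ (v⊆R fzero) (∈-vecsOver v (λ i → v⊆R (fsuc i)))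

∣entry∣≤absSum : ∀ {k} (λs : Vec ℤ k) i → ∣ lookup λs i ∣ ≤ absSum λs
∣entry∣≤absSum (l ∷ λs) fzero    = ℕₚ.m≤m+n ∣ l ∣ (absSum λs)
∣entry∣≤absSum (l ∷ λs) (fsuc i) = ℕₚ.≤-trans (∣entry∣≤absSum λs i) (ℕₚ.m≤n+m (absSum λs) ∣ l ∣)

module _ (h : ℕ) {k : ℕ} (a : Vec ℤ k) where

  coefficientVecs : List (Vec ℤ k)
  coefficientVecs = List.filter (λ λs → absSum λs ℕₚ.≟ h) (vecsOver (range h) k)

  signedSumsetList : List ℤ
  signedSumsetList = List.deduplicate ℤ._≟_ (List.map (weightedSum a) coefficientVecs)

  signedSumset-hasCard : HasCard (InSignedSumset h a) (length signedSumsetList)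
  signedSumset-hasCard = signedSumsetList , deduplicate-! _ , (λ x → mk⇔ sound (complete x)) , refl
    where
    sound : ∀ {x} → x ∈ signedSumsetList → InSignedSumset h a x
    sound x∈ with ∈-map⁻ (weightedSum a) (∈-deduplicate⁻ ℤ._≟_ _ x∈)
    ... | λs , λs∈ , refl = λs , proj₂ (∈-filter⁻ (λ λs → absSum λs ℕₚ.≟ h) {xs = vecsOver (range h) k} λs∈) , refl
    complete : ∀ x → InSignedSumset h a x → x ∈ signedSumsetList
    complete x (λs , refl , refl) = ∈-deduplicate⁺ ℤ._≟_ (∈-map⁺ (weightedSum a)
      (∈-filter⁺ (λ λs → absSum λs ℕₚ.≟ h)
                 (∈-vecsOver λs (λ i → ∈-range⁺ (lookup λs i) (∣entry∣≤absSum λs i))) refl))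

lookup-interval : ∀ k i → lookup (interval k) i ≡ + toℕ i
lookup-interval k = Vecₚ.lookup∘tabulate (λ i → + toℕ i)

interval-bounded : ∀ k i → ∣ lookup (interval (suc k)) i ∣ ≤ k
interval-bounded k i = subst (λ z → ∣ z ∣ ≤ k) (sym (lookup-interval (suc k) i)) (Finₚ.toℕ≤pred[n] i)

theorem5 : (h k : ℕ) → h ≥ 1 →
    ((a : Vec ℕ k) → Injective _≡_ _≡_ (lookup a) → Σ (Fin k) (λ j → lookup a j ≡ 0) →
      Σ ℕ (λ n → HasCard (InSignedSumset h (Data.Vec.map +_ a)) n ×
        (n ≥ 2 * h * k ∸ 2 * h + 1)))
    × (k ≥ 1 → HasCard (InSignedSumset h (interval k)) (2 * h * k ∸ 2 * h + 1))
theorem5 h zero    _ = (λ { _ _ (() , _) }) , λ ()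
theorem5 h (suc k) _ = lowerBound , intervalCard
  where
  bound≡ : 2 * h * suc k ∸ 2 * h + 1 ≡ 2 * h * k + 1
  bound≡ = cong (_+ 1) (trans (cong (_∸ 2 * h) (ℕₚ.*-suc (2 * h) k)) (ℕₚ.m+n∸m≡n (2 * h) (2 * h * k)))

  lowerBound : (a : Vec ℕ (suc k)) → Injective _≡_ _≡_ (lookup a) → Σ (Fin (suc k)) (λ j → lookup a j ≡ 0) →
               Σ ℕ (λ n → HasCard (InSignedSumset h (Data.Vec.map +_ a)) n × (n ≥ 2 * h * suc k ∸ 2 * h + 1))
  lowerBound a a-inj _ =
    length (signedSumsetList h ℤa) , signedSumset-hasCard h ℤa ,
    subst (_≤ length (signedSumsetList h ℤa)) (sym bound≡)
      (signedSumset-card≥ h ℤa (lookup a) a-inj (λ i → Vecₚ.lookup-map i +_ a) (signedSumset-hasCard h ℤa))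
    where
    ℤa : Vec ℤ (suc k)
    ℤa = Data.Vec.map +_ a

  intervalCard : suc k ≥ 1 → HasCard (InSignedSumset h (interval (suc k))) (2 * h * suc k ∸ 2 * h + 1)
  intervalCard _ = subst (HasCard (InSignedSumset h (interval (suc k)))) (trans n≡ (sym bound≡)) card
    where
    card : HasCard (InSignedSumset h (interval (suc k))) (length (signedSumsetList h (interval (suc k))))
    card = signedSumset-hasCard h (interval (suc k))
    n≡ : length (signedSumsetList h (interval (suc k))) ≡ 2 * h * k + 1
    n≡ = ℕₚ.≤-antisym (signedSumset-card≤ (interval (suc k)) (interval-bounded k) card)
                      (signedSumset-card≥ h (interval (suc k)) toℕ Finₚ.toℕ-injective (lookup-interval (suc k)) card)
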